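{- Let $M(A)$ and $N(B)$ be matched, let $i=r_M(A-B)$, and let $X\subseteq A\cup B$. Let $M_1=M\oplus I(B-A)$ and $N_0=N\oplus I^*(A-B)$. Then $$(M\mathbin{\Join} N)|X=M|(X\cap A)\mathbin{\Join} N'\quad\text{and}\quad (M\mathbin{\Join} N).X=M'\mathbin{\Join} N.(X\cap B),$$ where $N'$ is the $j$-th Higgs lift of $N|(X\cap B)$ towards $(M_1|X).(X\cap B)$, and $M'$ is the $k$-th Higgs lift of $(N_0.X)|(X\cap A)$ towards $M.(X\cap A)$, with $j=i-r_M(X-B)$ and $k=i-r_M(A-X)+r_N(B-X)-|B-(A\cup X)|$.
   Context: $K|X$ is restriction to $X$ and $K.X$ is the contraction of $K$ to $X$, i.e. $K/(E-X)$. $M(A)$, $N(B)$ matched means $M.(A\cap B)=N|(A\cap B)$. Free splice $M\mathbin{\Join} N$: matroid on $A\cup B$ with rank $r(X)=\min\{r_M(X\cap A)+|X-A|,\ r_N(X\cap B)+r_M(A-B)\}$. $I(Y)$ is the free matroid on $Y$ (all isthmuses), $I^*(Y)$ the matroid on $Y$ with all elements loops. For matroids $Q\unlhd P$ on the same set $E$ ($Q$ a quotient of $P$: every flat of $Q$ is a flat of $P$) and an integer $t$, the $t$-th Higgs lift of $Q$ towards $P$ is the matroid on $E$ with rank function $X\mapsto\min\{r_P(X),\,t+r_Q(X)\}$ if $t\ge 0$, and is $Q$ if $t<0$. (In the statement, the relevant pairs are quotient–lift pairs.) -}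

module Defs where

open import Data.Nat using (ℕ; _+_; _∸_; _≤_; _⊓_)
open import Data.Integer using (ℤ; +_; -[1+_])
open import Data.Fin.Subset using (Subset; _⊆_; _∩_; _∪_; _─_; ∣_∣; ⊥)
open import Data.Product using (_×_)
open import Relation.Binary.PropositionalEquality using (_≡_)

-- A (finite) matroid, given by its ground set E ⊆ Fin n and its rank
-- function.  Only the values of the rank function on subsets of E matter.
record RawMatroid (n : ℕ) : Set where
  constructor mkMatroid
  field
    ground : Subset n
    rank   : Subset n → ℕ
open RawMatroid public

record IsMatroid {n : ℕ} (M : RawMatroid n) : Set where
  field
    rank-≤-card : ∀ X → X ⊆ ground M → rank M X ≤ ∣ X ∣
    rank-mono   : ∀ X Y → X ⊆ Y → Y ⊆ ground M → rank M X ≤ rank M Y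
    rank-submod : ∀ X Y → X ⊆ ground M → Y ⊆ ground M →
                  rank M (X ∪ Y) + rank M (X ∩ Y) ≤ rank M X + rank M Y

_≅_ : ∀ {n} → RawMatroid n → RawMatroid n → Set
M ≅ N = (ground M ≡ ground N) × (∀ Y → Y ⊆ ground M → rank M Y ≡ rank N Y)
infix 4 _≅_

_∣ʳ_ : ∀ {n} → RawMatroid n → Subset n → RawMatroid n
K ∣ʳ X = mkMatroid X (λ Y → rank K (Y ∩ X))

-- Contraction to X:  K.X = K/(E - X).
_·_ : ∀ {n} → RawMatroid n → Subset n → RawMatroid n
K · X = mkMatroid X (λ Y → rank K ((Y ∩ X) ∪ (ground K ─ X)) ∸ rank K (ground K ─ X))

infixl 8 _∣ʳ_ _·_

-- Direct sum (of matroids on disjoint ground sets).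
_⊕_ : ∀ {n} → RawMatroid n → RawMatroid n → RawMatroid n
M ⊕ N = mkMatroid (ground M ∪ ground N)
                  (λ Y → rank M (Y ∩ ground M) + rank N (Y ∩ ground N))

I : ∀ {n} → Subset n → RawMatroid n
I Y = mkMatroid Y (λ Z → ∣ Z ∩ Y ∣)

I* : ∀ {n} → Subset n → RawMatroid n
I* Y = mkMatroid Y (λ _ → 0)

_⋈_ : ∀ {n} → RawMatroid n → RawMatroid n → RawMatroid n
M ⋈ N = mkMatroid (A ∪ B)
  (λ X → (rank M (X ∩ A) + ∣ X ─ A ∣) ⊓ (rank N (X ∩ B) + rank M (A ─ B)))
  where
    A = ground M
    B = ground N
infixl 6 _⋈_

higgs : ∀ {n} → RawMatroid n → RawMatroid n → ℤ → RawMatroid n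
higgs Q P (+ t)    = mkMatroid (ground Q) (λ X → rank P X ⊓ (t + rank Q X))
higgs Q P -[1+ _ ] = Q

Matched : ∀ {n} → RawMatroid n → RawMatroid n → Set
Matched M N = M · (ground M ∩ ground N) ≅ N ∣ʳ (ground M ∩ ground N)

module Submission where

-- After
-- normalising the sets involved (a Boolean identity under Y ⊆ X ⊆ A ∪ B), every
-- rank is a minimum of sums of ranks in M and N, and the claims become identities
-- between minima in ℕ. For the restriction, monotonicity of r_M makes one term of
-- the Higgs lift redundant. For the contraction, the sign of k records which term
-- realises the rank of the contracted set (A ∪ B) − X; the remaining terms
-- collapse by submodularity of r_M and r_N, which the matching lets one combine
-- through r_N Z + i = r_M (Z ∪ (A − B)) for Z ⊆ A ∩ B.

open import Data.Fin.Subset using (Subset; _⊆_; _∩_; _∪_; _─_; ∣_∣)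
open import Data.Nat using (ℕ)
open import Data.Product using (_×_; _,_)

open import Defs

module SubsetExpressions where

  open import Data.Bool using (Bool; true; false; _∧_; _∨_; if_then_else_; T)
  import Data.Bool as Bool
  open import Data.Bool.Properties using (T-∧)
  open import Data.Fin using (Fin; zero; suc)
  open import Data.Fin.Subset using (⊥)
  open import Data.Fin.Subset.Properties using (drop-∷-⊆)
  open import Data.Nat using (zero; suc; _+_)
  open import Data.Nat.Properties using (+-suc)
  open import Data.Product using (proj₁; proj₂)
  open import Data.Vec using (Vec; []; _∷_; lookup; map; head; tail; here; there)
  open import Data.Vec.Properties using (lookup-map; ∷-injectiveˡ; ∷-injectiveʳ)
  open import Function using (_∘_)
  open import Function.Bundles using (Equivalence)
  open import Relation.Binary.PropositionalEquality
  open import Relation.Nullary.Decidable using (⌊_⌋; toWitness)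

  infixr 7 _∩ₑ_
  infixr 6 _∪ₑ_
  infixl 5 _─ₑ_

  data Expr (k : ℕ) : Set where
    var            : Fin k → Expr k
    ∅              : Expr k
    _∩ₑ_ _∪ₑ_ _─ₑ_ : Expr k → Expr k → Expr k

  ⟦_⟧ : ∀ {k n} → Expr k → Vec (Subset n) k → Subset n
  ⟦ var x ⟧  ρ = lookup ρ x
  ⟦ ∅ ⟧      ρ = ⊥
  ⟦ e ∩ₑ f ⟧ ρ = ⟦ e ⟧ ρ ∩ ⟦ f ⟧ ρ
  ⟦ e ∪ₑ f ⟧ ρ = ⟦ e ⟧ ρ ∪ ⟦ f ⟧ ρ
  ⟦ e ─ₑ f ⟧ ρ = ⟦ e ⟧ ρ ─ ⟦ f ⟧ ρ

  ⟦_⟧ᵇ : ∀ {k} → Expr k → Vec Bool k → Bool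
  ⟦ var x ⟧ᵇ  σ = lookup σ x
  ⟦ ∅ ⟧ᵇ      σ = false
  ⟦ e ∩ₑ f ⟧ᵇ σ = ⟦ e ⟧ᵇ σ ∧ ⟦ f ⟧ᵇ σ
  ⟦ e ∪ₑ f ⟧ᵇ σ = ⟦ e ⟧ᵇ σ ∨ ⟦ f ⟧ᵇ σ
  ⟦ e ─ₑ f ⟧ᵇ σ = if ⟦ f ⟧ᵇ σ then false else ⟦ e ⟧ᵇ σ   -- matches on f like _─_, so ⟦⟧-∷ computes

  ⟦⟧-∷ : ∀ {k n} (e : Expr k) (ρ : Vec (Subset (suc n)) k) →
         ⟦ e ⟧ ρ ≡ ⟦ e ⟧ᵇ (map head ρ) ∷ ⟦ e ⟧ (map tail ρ)
  ⟦⟧-∷ (var x) ρ with lookup ρ x | lookup-map x head ρ | lookup-map x tail ρ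
  ... | b ∷ p | headˣ | tailˣ = sym (cong₂ _∷_ headˣ tailˣ)
  ⟦⟧-∷ ∅ ρ = refl
  ⟦⟧-∷ (e ∩ₑ f) ρ rewrite ⟦⟧-∷ e ρ | ⟦⟧-∷ f ρ = refl
  ⟦⟧-∷ (e ∪ₑ f) ρ rewrite ⟦⟧-∷ e ρ | ⟦⟧-∷ f ρ = refl
  ⟦⟧-∷ (e ─ₑ f) ρ rewrite ⟦⟧-∷ e ρ | ⟦⟧-∷ f ρ with ⟦ f ⟧ᵇ (map head ρ)
  ... | true  = refl
  ... | false = refl

  every : ∀ k → (Vec Bool k → Bool) → Bool
  every zero    P = P []
  every (suc k) P = every k (P ∘ (false ∷_)) ∧ every k (P ∘ (true ∷_))

  every-sound : ∀ k (P : Vec Bool k → Bool) → T (every k P) → ∀ σ → T (P σ)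
  every-sound zero    P t []          = t
  every-sound (suc k) P t (false ∷ σ) = every-sound k _ (proj₁ (Equivalence.to T-∧ t)) σ
  every-sound (suc k) P t (true  ∷ σ) = every-sound k _ (proj₂ (Equivalence.to T-∧ t)) σ

  Tautology : ∀ {k} (h e f : Expr k) → Bool
  Tautology {k} h e f = every k λ σ → ⟦ h ⟧ᵇ σ ∨ ⌊ ⟦ e ⟧ᵇ σ Bool.≟ ⟦ f ⟧ᵇ σ ⌋

  -- Subsets are bit vectors, so an identity between them can be checked bit by
  -- bit; the hypothesis ⟦ h ⟧ ρ ≡ ⊥ excludes the bit patterns where h holds.
  solve-sets : ∀ {k} (h e f : Expr k) → T (Tautology h e f) →
               ∀ {n} (ρ : Vec (Subset n) k) → ⟦ h ⟧ ρ ≡ ⊥ → ⟦ e ⟧ ρ ≡ ⟦ f ⟧ ρ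
  solve-sets h e f taut {zero}  ρ _   = empty-unique (⟦ e ⟧ ρ) (⟦ f ⟧ ρ)
    where
    empty-unique : (p q : Subset 0) → p ≡ q
    empty-unique [] [] = refl
  solve-sets h e f taut {suc n} ρ h≡⊥ = begin
    ⟦ e ⟧ ρ                                   ≡⟨ ⟦⟧-∷ e ρ ⟩
    ⟦ e ⟧ᵇ (map head ρ) ∷ ⟦ e ⟧ (map tail ρ)  ≡⟨ cong₂ _∷_ heads tails ⟩
    ⟦ f ⟧ᵇ (map head ρ) ∷ ⟦ f ⟧ (map tail ρ)  ≡⟨ ⟦⟧-∷ f ρ ⟨
    ⟦ f ⟧ ρ                                   ∎
    where
    open ≡-Reasoning
    h∷≡⊥ : ⟦ h ⟧ᵇ (map head ρ) ∷ ⟦ h ⟧ (map tail ρ) ≡ false ∷ ⊥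
    h∷≡⊥ = trans (sym (⟦⟧-∷ h ρ)) h≡⊥
    agree : ∀ {b u v : Bool} → T (b ∨ ⌊ u Bool.≟ v ⌋) → b ≡ false → u ≡ v
    agree {u = u} {v} t refl = toWitness {a? = u Bool.≟ v} t
    heads : ⟦ e ⟧ᵇ (map head ρ) ≡ ⟦ f ⟧ᵇ (map head ρ)
    heads = agree (every-sound _ _ taut (map head ρ)) (∷-injectiveˡ h∷≡⊥)
    tails : ⟦ e ⟧ (map tail ρ) ≡ ⟦ f ⟧ (map tail ρ)
    tails = solve-sets h e f taut (map tail ρ) (∷-injectiveʳ h∷≡⊥)

  p─q≡⊥⇒p⊆q : ∀ {n} (p q : Subset n) → p ─ q ≡ ⊥ → p ⊆ q
  p─q≡⊥⇒p⊆q (true ∷ p) (true  ∷ q) _  here      = here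
  p─q≡⊥⇒p⊆q (true ∷ p) (false ∷ q) () here
  p─q≡⊥⇒p⊆q (_    ∷ p) (_     ∷ q) eq (there x) = there (p─q≡⊥⇒p⊆q p q (∷-injectiveʳ eq) x)

  p⊆q⇒p─q≡⊥ : ∀ {n} (p q : Subset n) → p ⊆ q → p ─ q ≡ ⊥
  p⊆q⇒p─q≡⊥ []          []          _   = refl
  p⊆q⇒p─q≡⊥ (true  ∷ p) (true  ∷ q) p⊆q = cong (false ∷_) (p⊆q⇒p─q≡⊥ p q (drop-∷-⊆ p⊆q))
  p⊆q⇒p─q≡⊥ (true  ∷ p) (false ∷ q) p⊆q with p⊆q here
  ... | ()
  p⊆q⇒p─q≡⊥ (false ∷ p) (true  ∷ q) p⊆q = cong (false ∷_) (p⊆q⇒p─q≡⊥ p q (drop-∷-⊆ p⊆q))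
  p⊆q⇒p─q≡⊥ (false ∷ p) (false ∷ q) p⊆q = cong (false ∷_) (p⊆q⇒p─q≡⊥ p q (drop-∷-⊆ p⊆q))

  p∩q≡⊥⇒∣p∪q∣≡∣p∣+∣q∣ : ∀ {n} (p q : Subset n) → p ∩ q ≡ ⊥ → ∣ p ∪ q ∣ ≡ ∣ p ∣ + ∣ q ∣
  p∩q≡⊥⇒∣p∪q∣≡∣p∣+∣q∣ []          []          _  = refl
  p∩q≡⊥⇒∣p∪q∣≡∣p∣+∣q∣ (true  ∷ p) (false ∷ q) eq =
    cong suc (p∩q≡⊥⇒∣p∪q∣≡∣p∣+∣q∣ p q (∷-injectiveʳ eq))
  p∩q≡⊥⇒∣p∪q∣≡∣p∣+∣q∣ (false ∷ p) (true  ∷ q) eq =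
    trans (cong suc (p∩q≡⊥⇒∣p∪q∣≡∣p∣+∣q∣ p q (∷-injectiveʳ eq))) (sym (+-suc _ _))
  p∩q≡⊥⇒∣p∪q∣≡∣p∣+∣q∣ (false ∷ p) (false ∷ q) eq = p∩q≡⊥⇒∣p∪q∣≡∣p∣+∣q∣ p q (∷-injectiveʳ eq)
  p∩q≡⊥⇒∣p∪q∣≡∣p∣+∣q∣ (true  ∷ p) (true  ∷ q) ()

  module SetReasoning {k n} (ρ : Vec (Subset n) k) (hyp : Expr k) (hyp≡⊥ : ⟦ hyp ⟧ ρ ≡ ⊥) where

    sets-≡ : (e f : Expr k) {_ : T (Tautology hyp e f)} → ⟦ e ⟧ ρ ≡ ⟦ f ⟧ ρ
    sets-≡ e f {taut} = solve-sets hyp e f taut ρ hyp≡⊥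

    sets-⊆ : (e f : Expr k) {_ : T (Tautology hyp (e ─ₑ f) ∅)} → ⟦ e ⟧ ρ ⊆ ⟦ f ⟧ ρ
    sets-⊆ e f {taut} = p─q≡⊥⇒p⊆q _ _ (solve-sets hyp (e ─ₑ f) ∅ taut ρ hyp≡⊥)

  Aₑ : ∀ {k} → Expr (suc k)
  Aₑ = var zero

  Bₑ : ∀ {k} → Expr (suc (suc k))
  Bₑ = var (suc zero)

  Xₑ : ∀ {k} → Expr (suc (suc (suc k)))
  Xₑ = var (suc (suc zero))

  Yₑ : ∀ {k} → Expr (suc (suc (suc (suc k))))
  Yₑ = var (suc (suc (suc zero)))

module Arithmetic where

  open import Data.Integer as ℤ using (ℤ; -[1+_]; _⊖_)
  open import Data.Integer.Properties using ([+m]-[+n]≡m⊖n; [1+m]⊖[1+n]≡m⊖n; pos-+)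
  import Data.Integer.Tactic.RingSolver as ℤ-Ring
  open import Data.List using ([]; _∷_)
  open import Data.Nat using (zero; suc; _+_; _∸_; _≤_; _<_; _⊓_; z≤n; s≤s; z<s)
  open import Data.Nat.Properties
  open import Data.Nat.Tactic.RingSolver using (solve)
  open import Relation.Binary.PropositionalEquality

  x≤y⇒x⊓z≡x⊓[y⊓z] : ∀ {x y} z → x ≤ y → x ⊓ z ≡ x ⊓ (y ⊓ z)
  x≤y⇒x⊓z≡x⊓[y⊓z] {x} {y} z x≤y = trans (cong (_⊓ z) (sym (m≤n⇒m⊓n≡m x≤y))) (⊓-assoc x y z)

  [x+k]⊓[y+k]∸k≡x⊓y : ∀ x y k → ((x + k) ⊓ (y + k)) ∸ k ≡ x ⊓ y
  [x+k]⊓[y+k]∸k≡x⊓y x y k = trans (cong (_∸ k) (sym (+-distribʳ-⊓ k x y))) (m+n∸n≡m (x ⊓ y) k)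

  [x∸m]⊓[y∸m]+m≡x⊓y : ∀ {x y m} → m ≤ x → m ≤ y → ((x ∸ m) ⊓ (y ∸ m)) + m ≡ x ⊓ y
  [x∸m]⊓[y∸m]+m≡x⊓y {x} {y} {m} m≤x m≤y =
    trans (cong (_+ m) (sym (∸-distribʳ-⊓ m x y))) (m∸n+n≡m (⊓-glb m≤x m≤y))

  x≤z+y⇒x∸m≤[z∸m]+y : ∀ {x y z m} → m ≤ z → x ≤ z + y → x ∸ m ≤ (z ∸ m) + y
  x≤z+y⇒x∸m≤[z∸m]+y {x} {y} {z} {m} m≤z x≤z+y =
    subst (x ∸ m ≤_) (+-∸-comm y m≤z) (∸-monoˡ-≤ m x≤z+y)

  [a⊓[t+g]]+ℓ⊓[b+[d⊓t]]≡[a+ℓ]⊓[b+t] : ∀ {a b g d t ℓ} → b ≤ g + ℓ → t ≤ d →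
    ((a ⊓ (t + g)) + ℓ) ⊓ (b + (d ⊓ t)) ≡ (a + ℓ) ⊓ (b + t)
  [a⊓[t+g]]+ℓ⊓[b+[d⊓t]]≡[a+ℓ]⊓[b+t] {a} {b} {g} {d} {t} {ℓ} b≤g+ℓ t≤d = begin-equality
    ((a ⊓ (t + g)) + ℓ) ⊓ (b + (d ⊓ t))
      ≡⟨ cong₂ _⊓_ (+-distribʳ-⊓ ℓ a (t + g)) (cong (b +_) (m≥n⇒m⊓n≡n t≤d)) ⟩
    ((a + ℓ) ⊓ (t + g + ℓ)) ⊓ (b + t)
      ≡⟨ ⊓-assoc (a + ℓ) (t + g + ℓ) (b + t) ⟩
    (a + ℓ) ⊓ ((t + g + ℓ) ⊓ (b + t))
      ≡⟨ cong ((a + ℓ) ⊓_) (m≥n⇒m⊓n≡n b+t≤t+g+ℓ) ⟩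
    (a + ℓ) ⊓ (b + t) ∎
    where
    open ≤-Reasoning
    b+t≤t+g+ℓ : b + t ≤ t + g + ℓ
    b+t≤t+g+ℓ = begin
      b + t      ≤⟨ +-monoˡ-≤ t b≤g+ℓ ⟩
      g + ℓ + t  ≡⟨ solve (g ∷ ℓ ∷ t ∷ []) ⟩
      t + g + ℓ  ∎

  -- The rank of a contraction of the free splice, in the two cases according to
  -- which term of the minimum realises the rank of the contracted set.
  contraction-⊓-nonneg : ∀ {α β ℓ μ m₀ n₀ i} → m₀ ≤ α → n₀ ≤ β → m₀ + μ ≤ i + n₀ →
    ((α + (ℓ + μ)) ⊓ (β + i)) ∸ ((m₀ + μ) ⊓ (n₀ + i))
      ≡ ((α ∸ m₀) + ℓ) ⊓ ((β ∸ n₀) + ((i + n₀) ∸ (m₀ + μ)))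
  contraction-⊓-nonneg {α} {β} {ℓ} {μ} {m₀} {n₀} {i} m₀≤α n₀≤β m₀+μ≤i+n₀
    with α ∸ m₀ | m∸n+n≡m m₀≤α | β ∸ n₀ | m∸n+n≡m n₀≤β | (i + n₀) ∸ (m₀ + μ) | m∸n+n≡m m₀+μ≤i+n₀
  ... | a | refl | b | refl | t | t+K≡i+n₀ = begin-equality
    ((a + m₀ + (ℓ + μ)) ⊓ (b + n₀ + i)) ∸ ((m₀ + μ) ⊓ (n₀ + i))
      ≡⟨ cong₂ (λ u v → (u ⊓ v) ∸ ((m₀ + μ) ⊓ (n₀ + i))) (solve (a ∷ m₀ ∷ ℓ ∷ μ ∷ [])) b+n₀+i≡[b+t]+[m₀+μ] ⟩
    (((a + ℓ) + (m₀ + μ)) ⊓ ((b + t) + (m₀ + μ))) ∸ ((m₀ + μ) ⊓ (n₀ + i))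
      ≡⟨ cong (((a + ℓ) + (m₀ + μ)) ⊓ ((b + t) + (m₀ + μ)) ∸_) (m≤n⇒m⊓n≡m (subst (m₀ + μ ≤_) (+-comm i n₀) m₀+μ≤i+n₀)) ⟩
    (((a + ℓ) + (m₀ + μ)) ⊓ ((b + t) + (m₀ + μ))) ∸ (m₀ + μ)
      ≡⟨ [x+k]⊓[y+k]∸k≡x⊓y (a + ℓ) (b + t) (m₀ + μ) ⟩
    (a + ℓ) ⊓ (b + t) ∎
    where
    open ≤-Reasoning
    b+n₀+i≡[b+t]+[m₀+μ] : b + n₀ + i ≡ (b + t) + (m₀ + μ)
    b+n₀+i≡[b+t]+[m₀+μ] = begin-equality
      b + n₀ + i        ≡⟨ solve (b ∷ n₀ ∷ i ∷ []) ⟩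
      b + (i + n₀)      ≡⟨ cong (b +_) (sym t+K≡i+n₀) ⟩
      b + (t + (m₀ + μ)) ≡⟨ sym (+-assoc b t (m₀ + μ)) ⟩
      (b + t) + (m₀ + μ) ∎

  contraction-⊓-neg : ∀ {α β γ ℓ μ m₀ n₀ i} → n₀ ≤ β → β ≤ γ + ℓ → γ + m₀ ≤ α + n₀ → i + n₀ ≤ m₀ + μ →
    ((α + (ℓ + μ)) ⊓ (β + i)) ∸ ((m₀ + μ) ⊓ (n₀ + i)) ≡ β ∸ n₀
  contraction-⊓-neg {α} {β} {γ} {ℓ} {μ} {m₀} {n₀} {i} n₀≤β β≤γ+ℓ γ+m₀≤α+n₀ i+n₀≤m₀+μ = begin-equality
    ((α + (ℓ + μ)) ⊓ (β + i)) ∸ ((m₀ + μ) ⊓ (n₀ + i))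
      ≡⟨ cong₂ _∸_ (m≥n⇒m⊓n≡n β+i≤α+ℓ+μ) (m≥n⇒m⊓n≡n (subst (_≤ m₀ + μ) (+-comm i n₀) i+n₀≤m₀+μ)) ⟩
    (β + i) ∸ (n₀ + i)
      ≡⟨ cong₂ _∸_ (+-comm β i) (+-comm n₀ i) ⟩
    (i + β) ∸ (i + n₀)
      ≡⟨ [m+n]∸[m+o]≡n∸o i β n₀ ⟩
    β ∸ n₀ ∎
    where
    open ≤-Reasoning
    β+i≤α+ℓ+μ : β + i ≤ α + (ℓ + μ)
    β+i≤α+ℓ+μ = +-cancelʳ-≤ m₀ _ _ (begin
      β + i + m₀          ≤⟨ +-monoˡ-≤ m₀ (+-monoˡ-≤ i β≤γ+ℓ) ⟩
      γ + ℓ + i + m₀      ≡⟨ solve (γ ∷ ℓ ∷ i ∷ m₀ ∷ []) ⟩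
      (γ + m₀) + (ℓ + i)  ≤⟨ +-monoˡ-≤ (ℓ + i) γ+m₀≤α+n₀ ⟩
      (α + n₀) + (ℓ + i)  ≡⟨ solve (α ∷ n₀ ∷ ℓ ∷ i ∷ []) ⟩
      α + ℓ + (i + n₀)    ≤⟨ +-monoʳ-≤ (α + ℓ) i+n₀≤m₀+μ ⟩
      α + ℓ + (m₀ + μ)    ≡⟨ solve (α ∷ ℓ ∷ m₀ ∷ μ ∷ []) ⟩
      α + (ℓ + μ) + m₀    ∎)

  [+a]-[+b]+[+c]-[+d]≡[a+c]⊖[b+d] : ∀ a b c d →
    ℤ.+ a ℤ.- ℤ.+ b ℤ.+ ℤ.+ c ℤ.- ℤ.+ d ≡ (a + c) ⊖ (b + d)
  [+a]-[+b]+[+c]-[+d]≡[a+c]⊖[b+d] a b c d = begin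
    ℤ.+ a ℤ.- ℤ.+ b ℤ.+ ℤ.+ c ℤ.- ℤ.+ d      ≡⟨ regroup (ℤ.+ a) (ℤ.+ b) (ℤ.+ c) (ℤ.+ d) ⟩
    (ℤ.+ a ℤ.+ ℤ.+ c) ℤ.- (ℤ.+ b ℤ.+ ℤ.+ d)  ≡⟨ cong₂ ℤ._-_ (sym (pos-+ a c)) (sym (pos-+ b d)) ⟩
    ℤ.+ (a + c) ℤ.- ℤ.+ (b + d)              ≡⟨ [+m]-[+n]≡m⊖n (a + c) (b + d) ⟩
    (a + c) ⊖ (b + d)                        ∎
    where
    open ≡-Reasoning
    regroup : ∀ p q r s → p ℤ.- q ℤ.+ r ℤ.- s ≡ (p ℤ.+ r) ℤ.- (q ℤ.+ s)
    regroup = ℤ-Ring.solve-∀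

  -- Two submodular inequalities, one in N and one in M, glued along the
  -- matching identities z + i ≡ w.
  submodular-transfer : ∀ {g z₀ z₁ n₀ i a m₀ w₀ w₁} →
    g + z₀ ≤ n₀ + z₁ → z₀ + i ≡ w₀ → z₁ + i ≡ w₁ → w₁ + m₀ ≤ a + w₀ → g + m₀ ≤ a + n₀
  submodular-transfer {g} {z₀} {z₁} {n₀} {i} {a} {m₀} g+z₀≤n₀+z₁ refl refl w₁+m₀≤a+w₀ =
    +-cancelʳ-≤ (z₀ + i) _ _ (begin
      g + m₀ + (z₀ + i)        ≡⟨ solve (g ∷ m₀ ∷ z₀ ∷ i ∷ []) ⟩
      (g + z₀) + i + m₀        ≤⟨ +-monoˡ-≤ m₀ (+-monoˡ-≤ i g+z₀≤n₀+z₁) ⟩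
      (n₀ + z₁) + i + m₀       ≡⟨ solve (n₀ ∷ z₁ ∷ i ∷ m₀ ∷ []) ⟩
      n₀ + ((z₁ + i) + m₀)     ≤⟨ +-monoʳ-≤ n₀ w₁+m₀≤a+w₀ ⟩
      n₀ + (a + (z₀ + i))      ≡⟨ solve (n₀ ∷ a ∷ z₀ ∷ i ∷ []) ⟩
      a + n₀ + (z₀ + i)        ∎)
    where open ≤-Reasoning

  data SignedDifference (m n : ℕ) : ℤ → Set where
    nonneg : n ≤ m → SignedDifference m n (ℤ.+ (m ∸ n))
    neg    : m < n → ∀ x → SignedDifference m n -[1+ x ]

  signed-difference : ∀ m n → SignedDifference m n (m ⊖ n)
  signed-difference zero    zero    = nonneg z≤n
  signed-difference (suc m) zero    = nonneg z≤n
  signed-difference zero    (suc n) = neg z<s n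
  signed-difference (suc m) (suc n) =
    subst (SignedDifference (suc m) (suc n)) (sym ([1+m]⊖[1+n]≡m⊖n m n)) (shift (signed-difference m n))
    where
    shift : ∀ {z} → SignedDifference m n z → SignedDifference (suc m) (suc n) z
    shift (nonneg n≤m) = nonneg (s≤s n≤m)
    shift (neg m<n x)  = neg (s≤s m<n) x

module RankLemmas where

  open import Data.Fin using (zero; suc)
  open import Data.Nat using (_+_; _∸_; _≤_)
  open import Data.Nat.Properties using (m≤m+n; +-monoʳ-≤; m∸n+n≡m; module ≤-Reasoning)
  open import Data.Product using (proj₂)
  open import Data.Vec using ([]; _∷_)
  open import Relation.Binary.PropositionalEquality
  open SubsetExpressions
  open IsMatroid

  rank-∪-≤ : ∀ {n} {K : RawMatroid n} → IsMatroid K → ∀ {P Q} → P ⊆ ground K → Q ⊆ ground K →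
             rank K (P ∪ Q) ≤ rank K P + ∣ Q ∣
  rank-∪-≤ {K = K} isK {P} {Q} P⊆E Q⊆E = begin
    rank K (P ∪ Q)                   ≤⟨ m≤m+n _ _ ⟩
    rank K (P ∪ Q) + rank K (P ∩ Q)  ≤⟨ rank-submod isK P Q P⊆E Q⊆E ⟩
    rank K P + rank K Q              ≤⟨ +-monoʳ-≤ (rank K P) (rank-≤-card isK Q Q⊆E) ⟩
    rank K P + ∣ Q ∣                 ∎
    where open ≤-Reasoning

  matched-rank : ∀ {n} {M N : RawMatroid n} → IsMatroid M → Matched M N →
                 ∀ {Z} → Z ⊆ ground M ∩ ground N →
                 rank N Z + rank M (ground M ─ ground N) ≡ rank M (Z ∪ (ground M ─ ground N))
  matched-rank {n} {M} {N} isM matched {Z} Z⊆A∩B = begin-equality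
    rank N Z + rank M (A ─ B)
      ≡⟨ cong (λ W → rank N W + rank M (A ─ B)) (sets-≡ Zₑ (Zₑ ∩ₑ (Aₑ ∩ₑ Bₑ))) ⟩
    rank N (Z ∩ (A ∩ B)) + rank M (A ─ B)
      ≡⟨ cong (_+ rank M (A ─ B)) (proj₂ matched Z Z⊆A∩B) ⟨
    (rank M ((Z ∩ (A ∩ B)) ∪ (A ─ (A ∩ B))) ∸ rank M (A ─ (A ∩ B))) + rank M (A ─ B)
      ≡⟨ cong₂ (λ W V → (rank M W ∸ rank M V) + rank M (A ─ B))
               (sets-≡ ((Zₑ ∩ₑ (Aₑ ∩ₑ Bₑ)) ∪ₑ (Aₑ ─ₑ (Aₑ ∩ₑ Bₑ))) (Zₑ ∪ₑ (Aₑ ─ₑ Bₑ)))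
               (sets-≡ (Aₑ ─ₑ (Aₑ ∩ₑ Bₑ)) (Aₑ ─ₑ Bₑ)) ⟩
    (rank M (Z ∪ (A ─ B)) ∸ rank M (A ─ B)) + rank M (A ─ B)
      ≡⟨ m∸n+n≡m (rank-mono isM _ _ (sets-⊆ (Aₑ ─ₑ Bₑ) (Zₑ ∪ₑ (Aₑ ─ₑ Bₑ))) (sets-⊆ (Zₑ ∪ₑ (Aₑ ─ₑ Bₑ)) Aₑ)) ⟩
    rank M (Z ∪ (A ─ B)) ∎
    where
    open ≤-Reasoning
    A B : Subset n
    A = ground M
    B = ground N
    Zₑ : Expr 3
    Zₑ = var (suc (suc zero))
    open SetReasoning (A ∷ B ∷ Z ∷ []) (Zₑ ─ₑ (Aₑ ∩ₑ Bₑ)) (p⊆q⇒p─q≡⊥ Z (A ∩ B) Z⊆A∩B)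

module Splice {n : ℕ} (M N : RawMatroid n) (isM : IsMatroid M) (isN : IsMatroid N)
              (matched : Matched M N) (X : Subset n) (X⊆A∪B : X ⊆ ground M ∪ ground N) where

  open import Data.Fin.Subset using (⊥)
  open import Data.Fin.Subset.Properties using (∣⊥∣≡0; ∪-identityˡ)
  open import Data.Integer as ℤ using (ℤ; -[1+_]; _⊖_)
  open import Data.Nat using (_+_; _∸_; _≤_; _⊓_)
  open import Data.Nat.Properties
  open import Algebra.Properties.CommutativeSemigroup +-commutativeSemigroup using (xy∙z≈xz∙y)
  open import Data.Vec using ([]; _∷_)
  open import Relation.Binary.PropositionalEquality
  open SubsetExpressions
  open Arithmetic
  open RankLemmas
  open IsMatroid

  A B : Subset n
  A = ground M
  B = ground N

  i m m₀ n₀ μ δ : ℕ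
  i  = rank M (A ─ B)
  m  = rank M (X ─ B)
  m₀ = rank M (A ─ X)
  n₀ = rank N (B ─ X)
  μ  = ∣ B ─ (A ∪ X) ∣
  δ  = rank M ((X ─ B) ∪ (A ─ X))

  N′ : RawMatroid n
  N′ = higgs (N ∣ʳ (X ∩ B)) ((M ⊕ I (B ─ A)) ∣ʳ X · (X ∩ B)) (ℤ.+ (i ∸ m))

  Q : RawMatroid n
  Q = (N ⊕ I* (A ─ B)) · X ∣ʳ (X ∩ A)

  M′ : ℤ → RawMatroid n
  M′ = higgs Q (M · (X ∩ A))

  open SetReasoning (A ∷ B ∷ X ∷ []) (Xₑ ─ₑ (Aₑ ∪ₑ Bₑ)) (p⊆q⇒p─q≡⊥ X (A ∪ B) X⊆A∪B)
    renaming (sets-≡ to ≡ˣ; sets-⊆ to ⊆ˣ)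

  X≡[X∩A]∪[X∩B] : X ≡ (X ∩ A) ∪ (X ∩ B)
  X≡[X∩A]∪[X∩B] = ≡ˣ Xₑ ((Xₑ ∩ₑ Aₑ) ∪ₑ (Xₑ ∩ₑ Bₑ))

  m≤i : m ≤ i
  m≤i = rank-mono isM _ _ (⊆ˣ (Xₑ ─ₑ Bₑ) (Aₑ ─ₑ Bₑ)) (⊆ˣ (Aₑ ─ₑ Bₑ) Aₑ)

  -- Split B − X into its part Z₀ inside A, which matching transfers to M, and
  -- the part outside A, which costs at most μ.
  n₀+i≤δ+μ : n₀ + i ≤ δ + μ
  n₀+i≤δ+μ = begin
    n₀ + i                               ≤⟨ +-monoˡ-≤ i n₀≤rZ₀+μ ⟩
    rank N Z₀ + μ + i                    ≡⟨ xy∙z≈xz∙y (rank N Z₀) μ i ⟩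
    rank N Z₀ + i + μ                    ≡⟨ cong (_+ μ) (matched-rank {N = N} isM matched (⊆ˣ Z₀ₑ (Aₑ ∩ₑ Bₑ))) ⟩
    rank M (Z₀ ∪ (A ─ B)) + μ            ≤⟨ +-monoˡ-≤ μ (rank-mono isM _ _ (⊆ˣ (Z₀ₑ ∪ₑ (Aₑ ─ₑ Bₑ)) δₑ) (⊆ˣ δₑ Aₑ)) ⟩
    δ + μ                                ∎
    where
    open ≤-Reasoning
    Z₀ₑ δₑ : Expr 3
    Z₀ₑ = (Bₑ ─ₑ Xₑ) ∩ₑ Aₑ
    δₑ  = (Xₑ ─ₑ Bₑ) ∪ₑ (Aₑ ─ₑ Xₑ)
    Z₀ : Subset n
    Z₀ = (B ─ X) ∩ A
    n₀≤rZ₀+μ : n₀ ≤ rank N Z₀ + μ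
    n₀≤rZ₀+μ = ≤-trans
      (rank-mono isN _ _ (⊆ˣ (Bₑ ─ₑ Xₑ) (Z₀ₑ ∪ₑ (Bₑ ─ₑ (Aₑ ∪ₑ Xₑ)))) (⊆ˣ (Z₀ₑ ∪ₑ (Bₑ ─ₑ (Aₑ ∪ₑ Xₑ))) Bₑ))
      (rank-∪-≤ isN (⊆ˣ Z₀ₑ Bₑ) (⊆ˣ (Bₑ ─ₑ (Aₑ ∪ₑ Xₑ)) Bₑ))

  rank-splice-contracted : rank (M ⋈ N) ((A ∪ B) ─ X) ≡ (m₀ + μ) ⊓ (n₀ + i)
  rank-splice-contracted =
    cong₂ _⊓_ (cong₂ _+_ (cong (rank M) (≡ˣ (((Aₑ ∪ₑ Bₑ) ─ₑ Xₑ) ∩ₑ Aₑ) (Aₑ ─ₑ Xₑ)))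
                         (cong ∣_∣ (≡ˣ (((Aₑ ∪ₑ Bₑ) ─ₑ Xₑ) ─ₑ Aₑ) (Bₑ ─ₑ (Aₑ ∪ₑ Xₑ)))))
              (cong (λ W → rank N W + i) (≡ˣ (((Aₑ ∪ₑ Bₑ) ─ₑ Xₑ) ∩ₑ Bₑ) (Bₑ ─ₑ Xₑ)))

  rank-M·[X∩A] : ∀ Z → rank (M · (X ∩ A)) Z ≡ rank M ((Z ∩ (X ∩ A)) ∪ (A ─ X)) ∸ m₀
  rank-M·[X∩A] Z = cong (λ W → rank M ((Z ∩ (X ∩ A)) ∪ W) ∸ rank M W) (≡ˣ (Aₑ ─ₑ (Xₑ ∩ₑ Aₑ)) (Aₑ ─ₑ Xₑ))

  rank-N·[X∩B] : ∀ Z → rank (N · (X ∩ B)) Z ≡ rank N ((Z ∩ (X ∩ B)) ∪ (B ─ X)) ∸ n₀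
  rank-N·[X∩B] Z = cong (λ W → rank N ((Z ∩ (X ∩ B)) ∪ W) ∸ rank N W) (≡ˣ (Bₑ ─ₑ (Xₑ ∩ₑ Bₑ)) (Bₑ ─ₑ Xₑ))

  rank-Q : ∀ Z → rank Q Z ≡ rank N ((((Z ∩ (X ∩ A)) ∩ X) ∪ ((B ∪ (A ─ B)) ─ X)) ∩ B) ∸ n₀
  rank-Q Z = cong₂ _∸_ (+-identityʳ _)
    (trans (+-identityʳ _) (cong (rank N) (≡ˣ (((Bₑ ∪ₑ (Aₑ ─ₑ Bₑ)) ─ₑ Xₑ) ∩ₑ Bₑ) (Bₑ ─ₑ Xₑ))))

  rank-Q[X∩A─X∩B]≡0 : rank Q ((X ∩ A) ─ (X ∩ B)) ≡ 0
  rank-Q[X∩A─X∩B]≡0 = trans (rank-Q _)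
    (trans (cong (λ W → rank N W ∸ n₀) (≡ˣ ((((((Xₑ ∩ₑ Aₑ) ─ₑ (Xₑ ∩ₑ Bₑ)) ∩ₑ (Xₑ ∩ₑ Aₑ)) ∩ₑ Xₑ) ∪ₑ ((Bₑ ∪ₑ (Aₑ ─ₑ Bₑ)) ─ₑ Xₑ)) ∩ₑ Bₑ) (Bₑ ─ₑ Xₑ)))
           (n∸n≡0 n₀))

  rank-M·[X∩A][X∩A─X∩B] : rank (M · (X ∩ A)) ((X ∩ A) ─ (X ∩ B)) ≡ δ ∸ m₀
  rank-M·[X∩A][X∩A─X∩B] = trans (rank-M·[X∩A] _)
    (cong (λ W → rank M W ∸ m₀) (≡ˣ ((((Xₑ ∩ₑ Aₑ) ─ₑ (Xₑ ∩ₑ Bₑ)) ∩ₑ (Xₑ ∩ₑ Aₑ)) ∪ₑ (Aₑ ─ₑ Xₑ)) ((Xₑ ─ₑ Bₑ) ∪ₑ (Aₑ ─ₑ Xₑ))))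

  rank-M₁∣ʳX[X─X∩B]≡m : rank ((M ⊕ I (B ─ A)) ∣ʳ X) (X ─ (X ∩ B)) ≡ m
  rank-M₁∣ʳX[X─X∩B]≡m = trans
    (cong₂ _+_ (cong (rank M) (≡ˣ (((Xₑ ─ₑ (Xₑ ∩ₑ Bₑ)) ∩ₑ Xₑ) ∩ₑ Aₑ) (Xₑ ─ₑ Bₑ)))
               (trans (cong ∣_∣ (≡ˣ ((((Xₑ ─ₑ (Xₑ ∩ₑ Bₑ)) ∩ₑ Xₑ) ∩ₑ (Bₑ ─ₑ Aₑ)) ∩ₑ (Bₑ ─ₑ Aₑ)) ∅)) (∣⊥∣≡0 n)))
    (+-identityʳ m)

  module _ (Y : Subset n) (Y⊆X : Y ⊆ X) where

    open SetReasoning (A ∷ B ∷ X ∷ Y ∷ []) ((Xₑ ─ₑ (Aₑ ∪ₑ Bₑ)) ∪ₑ (Yₑ ─ₑ Xₑ))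
      (trans (cong₂ _∪_ (p⊆q⇒p─q≡⊥ X (A ∪ B) X⊆A∪B) (p⊆q⇒p─q≡⊥ Y X Y⊆X)) (∪-identityˡ ⊥))
      renaming (sets-≡ to ≡ʸ; sets-⊆ to ⊆ʸ)

    αₑ βₑ γₑ : Expr 4
    αₑ = (Yₑ ∩ₑ Aₑ) ∪ₑ (Aₑ ─ₑ Xₑ)
    βₑ = (Yₑ ∩ₑ Bₑ) ∪ₑ (Bₑ ─ₑ Xₑ)
    γₑ = (Yₑ ∩ₑ Aₑ ∩ₑ Bₑ) ∪ₑ (Bₑ ─ₑ Xₑ)

    α β γ ℓ : ℕ
    α = rank M ((Y ∩ A) ∪ (A ─ X))
    β = rank N ((Y ∩ B) ∪ (B ─ X))
    γ = rank N ((Y ∩ A ∩ B) ∪ (B ─ X))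
    ℓ = ∣ Y ─ A ∣

    m₀≤α : m₀ ≤ α
    m₀≤α = rank-mono isM _ _ (⊆ʸ (Aₑ ─ₑ Xₑ) αₑ) (⊆ʸ αₑ Aₑ)

    n₀≤β : n₀ ≤ β
    n₀≤β = rank-mono isN _ _ (⊆ʸ (Bₑ ─ₑ Xₑ) βₑ) (⊆ʸ βₑ Bₑ)

    n₀≤γ : n₀ ≤ γ
    n₀≤γ = rank-mono isN _ _ (⊆ʸ (Bₑ ─ₑ Xₑ) γₑ) (⊆ʸ γₑ Bₑ)

    β≤γ+ℓ : β ≤ γ + ℓ
    β≤γ+ℓ = ≤-trans (rank-mono isN _ _ (⊆ʸ βₑ (γₑ ∪ₑ (Yₑ ─ₑ Aₑ))) (⊆ʸ (γₑ ∪ₑ (Yₑ ─ₑ Aₑ)) Bₑ))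
                    (rank-∪-≤ isN (⊆ʸ γₑ Bₑ) (⊆ʸ (Yₑ ─ₑ Aₑ) Bₑ))

    γ+m₀≤α+n₀ : γ + m₀ ≤ α + n₀
    γ+m₀≤α+n₀ = submodular-transfer submodularᴺ
      (matched-rank {N = N} isM matched (⊆ʸ Z₀ₑ (Aₑ ∩ₑ Bₑ)))
      (matched-rank {N = N} isM matched (⊆ʸ Z₁ₑ (Aₑ ∩ₑ Bₑ)))
      submodularᴹ
      where
      Z₀ₑ Z₁ₑ : Expr 4
      Z₀ₑ = (Bₑ ─ₑ Xₑ) ∩ₑ Aₑ
      Z₁ₑ = (Yₑ ∩ₑ Aₑ ∩ₑ Bₑ) ∪ₑ Z₀ₑ
      Z₀ Z₁ AB : Subset n
      Z₀ = (B ─ X) ∩ A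
      Z₁ = (Y ∩ A ∩ B) ∪ Z₀
      AB = A ─ B
      submodularᴺ : γ + rank N Z₀ ≤ n₀ + rank N Z₁
      submodularᴺ = subst₂ (λ U V → rank N U + rank N V ≤ n₀ + rank N Z₁)
        (≡ʸ ((Bₑ ─ₑ Xₑ) ∪ₑ Z₁ₑ) γₑ) (≡ʸ ((Bₑ ─ₑ Xₑ) ∩ₑ Z₁ₑ) Z₀ₑ)
        (rank-submod isN _ _ (⊆ʸ (Bₑ ─ₑ Xₑ) Bₑ) (⊆ʸ Z₁ₑ Bₑ))
      submodularᴹ : rank M (Z₁ ∪ AB) + m₀ ≤ α + rank M (Z₀ ∪ AB)
      submodularᴹ = ≤-trans
        (+-monoʳ-≤ (rank M (Z₁ ∪ AB))
          (rank-mono isM _ _ (⊆ʸ (Aₑ ─ₑ Xₑ) (αₑ ∩ₑ (Z₀ₑ ∪ₑ (Aₑ ─ₑ Bₑ)))) (⊆ʸ (αₑ ∩ₑ (Z₀ₑ ∪ₑ (Aₑ ─ₑ Bₑ))) Aₑ)))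
        (subst (λ U → rank M U + rank M (((Y ∩ A) ∪ (A ─ X)) ∩ (Z₀ ∪ AB)) ≤ α + rank M (Z₀ ∪ AB))
          (≡ʸ (αₑ ∪ₑ (Z₀ₑ ∪ₑ (Aₑ ─ₑ Bₑ))) (Z₁ₑ ∪ₑ (Aₑ ─ₑ Bₑ)))
          (rank-submod isM _ _ (⊆ʸ αₑ Aₑ) (⊆ʸ (Z₀ₑ ∪ₑ (Aₑ ─ₑ Bₑ)) Aₑ)))

    ∣Y─X∩A∣≡ℓ : ∣ Y ─ (X ∩ A) ∣ ≡ ℓ
    ∣Y─X∩A∣≡ℓ = cong ∣_∣ (≡ʸ (Yₑ ─ₑ (Xₑ ∩ₑ Aₑ)) (Yₑ ─ₑ Aₑ))

    a b c : ℕ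
    a = rank M (Y ∩ A)
    b = rank M ((Y ∩ A ∩ B) ∪ (X ─ B))
    c = rank N (Y ∩ B)

    bₑ : Expr 4
    bₑ = (Yₑ ∩ₑ Aₑ ∩ₑ Bₑ) ∪ₑ (Xₑ ─ₑ Bₑ)

    a≤b : a ≤ b
    a≤b = rank-mono isM _ _ (⊆ʸ (Yₑ ∩ₑ Aₑ) bₑ) (⊆ʸ bₑ Aₑ)

    m≤b : m ≤ b
    m≤b = rank-mono isM _ _ (⊆ʸ (Xₑ ─ₑ Bₑ) bₑ) (⊆ʸ bₑ Aₑ)

    rank-M₁∣ʳX·[X∩B]-Y : rank ((M ⊕ I (B ─ A)) ∣ʳ X · (X ∩ B)) (Y ∩ (X ∩ B)) ≡ (b + ℓ) ∸ m
    rank-M₁∣ʳX·[X∩B]-Y = cong₂ _∸_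
      (cong₂ _+_ (cong (rank M) (≡ʸ ((Wₑ ∩ₑ Xₑ) ∩ₑ Aₑ) bₑ))
                 (cong ∣_∣ (≡ʸ (((Wₑ ∩ₑ Xₑ) ∩ₑ (Bₑ ─ₑ Aₑ)) ∩ₑ (Bₑ ─ₑ Aₑ)) (Yₑ ─ₑ Aₑ))))
      rank-M₁∣ʳX[X─X∩B]≡m
      where
      Wₑ : Expr 4
      Wₑ = ((Yₑ ∩ₑ (Xₑ ∩ₑ Bₑ)) ∩ₑ (Xₑ ∩ₑ Bₑ)) ∪ₑ (Xₑ ─ₑ (Xₑ ∩ₑ Bₑ))

    rank-M∣ʳ[X∩A]⋈N′ : rank ((M ∣ʳ (X ∩ A)) ⋈ N′) Y ≡ (a + ℓ) ⊓ ((((b + ℓ) ∸ m) ⊓ ((i ∸ m) + c)) + m)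
    rank-M∣ʳ[X∩A]⋈N′ = cong₂ _⊓_
      (cong₂ _+_ (cong (rank M) (≡ʸ ((Yₑ ∩ₑ (Xₑ ∩ₑ Aₑ)) ∩ₑ (Xₑ ∩ₑ Aₑ)) (Yₑ ∩ₑ Aₑ))) ∣Y─X∩A∣≡ℓ)
      (cong₂ _+_ (cong₂ _⊓_ rank-M₁∣ʳX·[X∩B]-Y
                            (cong (λ W → (i ∸ m) + rank N W) (≡ʸ ((Yₑ ∩ₑ (Xₑ ∩ₑ Bₑ)) ∩ₑ (Xₑ ∩ₑ Bₑ)) (Yₑ ∩ₑ Bₑ))))
                 (cong (rank M) (≡ʸ (((Xₑ ∩ₑ Aₑ) ─ₑ (Xₑ ∩ₑ Bₑ)) ∩ₑ (Xₑ ∩ₑ Aₑ)) (Xₑ ─ₑ Bₑ))))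

    -- Shifted back by m, the two terms of the lift are b + ℓ, dominated by a + ℓ, and c + i.
    restriction-rank : rank ((M ⋈ N) ∣ʳ X) Y ≡ rank ((M ∣ʳ (X ∩ A)) ⋈ N′) Y
    restriction-rank = begin-equality
      rank (M ⋈ N) (Y ∩ X)
        ≡⟨ cong (rank (M ⋈ N)) (≡ʸ (Yₑ ∩ₑ Xₑ) Yₑ) ⟩
      (a + ℓ) ⊓ (c + i)
        ≡⟨ x≤y⇒x⊓z≡x⊓[y⊓z] (c + i) (+-monoˡ-≤ ℓ a≤b) ⟩
      (a + ℓ) ⊓ ((b + ℓ) ⊓ (c + i))
        ≡⟨ cong (λ z → (a + ℓ) ⊓ ((b + ℓ) ⊓ z)) (+-comm c i) ⟩
      (a + ℓ) ⊓ ((b + ℓ) ⊓ (i + c))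
        ≡⟨ cong ((a + ℓ) ⊓_) (sym ([x∸m]⊓[y∸m]+m≡x⊓y (≤-trans m≤b (m≤m+n b ℓ)) (≤-trans m≤i (m≤m+n i c)))) ⟩
      (a + ℓ) ⊓ ((((b + ℓ) ∸ m) ⊓ ((i + c) ∸ m)) + m)
        ≡⟨ cong (λ z → (a + ℓ) ⊓ ((((b + ℓ) ∸ m) ⊓ z) + m)) (+-∸-comm c m≤i) ⟩
      (a + ℓ) ⊓ ((((b + ℓ) ∸ m) ⊓ ((i ∸ m) + c)) + m)
        ≡⟨ rank-M∣ʳ[X∩A]⋈N′ ⟨
      rank ((M ∣ʳ (X ∩ A)) ⋈ N′) Y ∎
      where open ≤-Reasoning

    contraction-rank : rank ((M ⋈ N) · X) Y ≡ ((α + (ℓ + μ)) ⊓ (β + i)) ∸ ((m₀ + μ) ⊓ (n₀ + i))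
    contraction-rank = cong₂ _∸_
      (cong₂ _⊓_ (cong₂ _+_ (cong (rank M) (≡ʸ (Sₑ ∩ₑ Aₑ) αₑ)) ∣S─A∣≡ℓ+μ)
                 (cong (λ W → rank N W + i) (≡ʸ (Sₑ ∩ₑ Bₑ) βₑ)))
      rank-splice-contracted
      where
      Sₑ : Expr 4
      Sₑ = (Yₑ ∩ₑ Xₑ) ∪ₑ ((Aₑ ∪ₑ Bₑ) ─ₑ Xₑ)
      ∣S─A∣≡ℓ+μ : ∣ ((Y ∩ X) ∪ ((A ∪ B) ─ X)) ─ A ∣ ≡ ℓ + μ
      ∣S─A∣≡ℓ+μ = trans (cong ∣_∣ (≡ʸ (Sₑ ─ₑ Aₑ) ((Yₑ ─ₑ Aₑ) ∪ₑ (Bₑ ─ₑ (Aₑ ∪ₑ Xₑ)))))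
                        (p∩q≡⊥⇒∣p∪q∣≡∣p∣+∣q∣ _ _ (≡ʸ ((Yₑ ─ₑ Aₑ) ∩ₑ (Bₑ ─ₑ (Aₑ ∪ₑ Xₑ))) ∅))

    rank-M·[X∩A]-Y : rank (M · (X ∩ A)) (Y ∩ (X ∩ A)) ≡ α ∸ m₀
    rank-M·[X∩A]-Y = trans (rank-M·[X∩A] _)
      (cong (λ W → rank M W ∸ m₀) (≡ʸ (((Yₑ ∩ₑ (Xₑ ∩ₑ Aₑ)) ∩ₑ (Xₑ ∩ₑ Aₑ)) ∪ₑ (Aₑ ─ₑ Xₑ)) αₑ))

    rank-Q-Y : rank Q (Y ∩ (X ∩ A)) ≡ γ ∸ n₀
    rank-Q-Y = trans (rank-Q _)
      (cong (λ W → rank N W ∸ n₀)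
            (≡ʸ (((((Yₑ ∩ₑ (Xₑ ∩ₑ Aₑ)) ∩ₑ (Xₑ ∩ₑ Aₑ)) ∩ₑ Xₑ) ∪ₑ ((Bₑ ∪ₑ (Aₑ ─ₑ Bₑ)) ─ₑ Xₑ)) ∩ₑ Bₑ) γₑ))

    rank-N·[X∩B]-Y : rank (N · (X ∩ B)) (Y ∩ (X ∩ B)) ≡ β ∸ n₀
    rank-N·[X∩B]-Y = trans (rank-N·[X∩B] _)
      (cong (λ W → rank N W ∸ n₀) (≡ʸ (((Yₑ ∩ₑ (Xₑ ∩ₑ Bₑ)) ∩ₑ (Xₑ ∩ₑ Bₑ)) ∪ₑ (Bₑ ─ₑ Xₑ)) βₑ))

    β∸n₀≤[γ∸n₀]+ℓ : β ∸ n₀ ≤ (γ ∸ n₀) + ℓ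
    β∸n₀≤[γ∸n₀]+ℓ = x≤z+y⇒x∸m≤[z∸m]+y n₀≤γ β≤γ+ℓ

    rank-M′⁺⋈N·[X∩B] : ∀ t → rank (M′ (ℤ.+ t) ⋈ N · (X ∩ B)) Y
                               ≡ (((α ∸ m₀) ⊓ (t + (γ ∸ n₀))) + ℓ) ⊓ ((β ∸ n₀) + ((δ ∸ m₀) ⊓ t))
    rank-M′⁺⋈N·[X∩B] t = cong₂ _⊓_
      (cong₂ _+_ (cong₂ _⊓_ rank-M·[X∩A]-Y (cong (t +_) rank-Q-Y)) ∣Y─X∩A∣≡ℓ)
      (cong₂ _+_ rank-N·[X∩B]-Y
                 (cong₂ _⊓_ rank-M·[X∩A][X∩A─X∩B] (trans (cong (t +_) rank-Q[X∩A─X∩B]≡0) (+-identityʳ t))))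

    rank-M′⁻⋈N·[X∩B] : ∀ x → rank (M′ -[1+ x ] ⋈ N · (X ∩ B)) Y ≡ ((γ ∸ n₀) + ℓ) ⊓ (β ∸ n₀)
    rank-M′⁻⋈N·[X∩B] x = cong₂ _⊓_
      (cong₂ _+_ rank-Q-Y ∣Y─X∩A∣≡ℓ)
      (trans (cong₂ _+_ rank-N·[X∩B]-Y rank-Q[X∩A─X∩B]≡0) (+-identityʳ (β ∸ n₀)))

    contraction-rank-nonneg : m₀ + μ ≤ i + n₀ →
      rank ((M ⋈ N) · X) Y ≡ rank (M′ (ℤ.+ ((i + n₀) ∸ (m₀ + μ))) ⋈ N · (X ∩ B)) Y
    contraction-rank-nonneg m₀+μ≤i+n₀ = begin-equality
      rank ((M ⋈ N) · X) Y
        ≡⟨ contraction-rank ⟩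
      ((α + (ℓ + μ)) ⊓ (β + i)) ∸ ((m₀ + μ) ⊓ (n₀ + i))
        ≡⟨ contraction-⊓-nonneg m₀≤α n₀≤β m₀+μ≤i+n₀ ⟩
      ((α ∸ m₀) + ℓ) ⊓ ((β ∸ n₀) + t)
        ≡⟨ [a⊓[t+g]]+ℓ⊓[b+[d⊓t]]≡[a+ℓ]⊓[b+t] {a = α ∸ m₀} β∸n₀≤[γ∸n₀]+ℓ t≤δ∸m₀ ⟨
      (((α ∸ m₀) ⊓ (t + (γ ∸ n₀))) + ℓ) ⊓ ((β ∸ n₀) + ((δ ∸ m₀) ⊓ t))
        ≡⟨ rank-M′⁺⋈N·[X∩B] t ⟨
      rank (M′ (ℤ.+ t) ⋈ N · (X ∩ B)) Y ∎
      where
      open ≤-Reasoning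
      t : ℕ
      t = (i + n₀) ∸ (m₀ + μ)
      t≤δ∸m₀ : t ≤ δ ∸ m₀
      t≤δ∸m₀ = begin
        (i + n₀) ∸ (m₀ + μ)  ≤⟨ ∸-monoˡ-≤ (m₀ + μ) (subst (_≤ δ + μ) (+-comm n₀ i) n₀+i≤δ+μ) ⟩
        (δ + μ) ∸ (m₀ + μ)   ≡⟨ cong₂ _∸_ (+-comm δ μ) (+-comm m₀ μ) ⟩
        (μ + δ) ∸ (μ + m₀)   ≡⟨ [m+n]∸[m+o]≡n∸o μ δ m₀ ⟩
        δ ∸ m₀               ∎

    contraction-rank-neg : i + n₀ ≤ m₀ + μ → ∀ x →
      rank ((M ⋈ N) · X) Y ≡ rank (M′ -[1+ x ] ⋈ N · (X ∩ B)) Y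
    contraction-rank-neg i+n₀≤m₀+μ x = begin-equality
      rank ((M ⋈ N) · X) Y
        ≡⟨ contraction-rank ⟩
      ((α + (ℓ + μ)) ⊓ (β + i)) ∸ ((m₀ + μ) ⊓ (n₀ + i))
        ≡⟨ contraction-⊓-neg {γ = γ} {ℓ = ℓ} {μ = μ} {m₀ = m₀} n₀≤β β≤γ+ℓ γ+m₀≤α+n₀ i+n₀≤m₀+μ ⟩
      β ∸ n₀
        ≡⟨ m≥n⇒m⊓n≡n β∸n₀≤[γ∸n₀]+ℓ ⟨
      ((γ ∸ n₀) + ℓ) ⊓ (β ∸ n₀)
        ≡⟨ rank-M′⁻⋈N·[X∩B] x ⟨
      rank (M′ -[1+ x ] ⋈ N · (X ∩ B)) Y ∎
      where open ≤-Reasoning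

  restriction : ∀ {j} → j ≡ ℤ.+ (i ∸ m) →
                (M ⋈ N) ∣ʳ X ≅ (M ∣ʳ (X ∩ A)) ⋈ higgs (N ∣ʳ (X ∩ B)) ((M ⊕ I (B ─ A)) ∣ʳ X · (X ∩ B)) j
  restriction refl = X≡[X∩A]∪[X∩B] , restriction-rank

  contraction : ∀ {k} → k ≡ (i + n₀) ⊖ (m₀ + μ) → (M ⋈ N) · X ≅ M′ k ⋈ N · (X ∩ B)
  contraction refl with (i + n₀) ⊖ (m₀ + μ) | signed-difference (i + n₀) (m₀ + μ)
  ... | _ | nonneg m₀+μ≤i+n₀ = X≡[X∩A]∪[X∩B] , λ Y Y⊆X → contraction-rank-nonneg Y Y⊆X m₀+μ≤i+n₀
  ... | _ | neg i+n₀<m₀+μ x  = X≡[X∩A]∪[X∩B] , λ Y Y⊆X → contraction-rank-neg Y Y⊆X (<⇒≤ i+n₀<m₀+μ) x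

open import Data.Integer using (ℤ; +_; _-_; _+_)
open import Data.Integer.Properties using ([+m]-[+n]≡m⊖n; ⊖-≥)
open import Relation.Binary.PropositionalEquality using (trans)
open Arithmetic using ([+a]-[+b]+[+c]-[+d]≡[a+c]⊖[b+d])

theorem5p4 : ∀ {n : ℕ} (M N : RawMatroid n) → IsMatroid M → IsMatroid N →
  Matched M N → (X : Subset n) → X ⊆ ground M ∪ ground N →
  let A = ground M
      B = ground N
      i = rank M (A ─ B)
      M₁ = M ⊕ I (B ─ A)
      N₀ = N ⊕ I* (A ─ B)
      j = + i - + rank M (X ─ B)
      k = + i - + rank M (A ─ X) + + rank N (B ─ X) - + ∣ B ─ (A ∪ X) ∣
      N′ = higgs (N ∣ʳ (X ∩ B)) ((M₁ ∣ʳ X) · (X ∩ B)) j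
      M′ = higgs ((N₀ · X) ∣ʳ (X ∩ A)) (M · (X ∩ A)) k
  in ((M ⋈ N) ∣ʳ X ≅ (M ∣ʳ (X ∩ A)) ⋈ N′) × ((M ⋈ N) · X ≅ M′ ⋈ (N · (X ∩ B)))
theorem5p4 M N isM isN matched X X⊆A∪B =
  restriction (trans ([+m]-[+n]≡m⊖n i m) (⊖-≥ m≤i)) ,
  contraction ([+a]-[+b]+[+c]-[+d]≡[a+c]⊖[b+d] i m₀ n₀ μ)
  where open Splice M N isM isN matched X X⊆A∪B
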